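{- Let $x\in\{0,1\}^{\mathbb{N}}$ be a binary sequence with $\mathrm{Dim}(x)<1$. Then $x$ is not strongly Kurtz random.
   Context: Fix an optimal prefix-free machine $U$ and let $K(\tau)=\min\{|\sigma|\mid U(\sigma)=\tau\}$ be prefix-free Kolmogorov complexity; $x\restriction n$ denotes the prefix of length $n$ of $x$. The effective packing dimension of $x$ is $\mathrm{Dim}(x):=\limsup_{n\to\infty}K(x\restriction n)/n$. A binary sequence $x$ is strongly Kurtz random if there is no computable function $r\colon\mathbb{N}\to\mathbb{N}$ with $K(x\restriction r(n))\le r(n)-n$ for all $n$. -}

module Defs where

open import Data.Nat using (ℕ; zero; suc; _+_; _*_; _∸_; _≤_; _<_)
open import Data.Bool using (Bool; true; false)
open import Data.Fin using (Fin)
open import Data.Vec using (Vec; []; _∷_; lookup)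
open import Data.List using (List; []; _∷_; _++_; length; map; upTo)
open import Data.Product using (Σ; ∃; _×_; _,_)
open import Relation.Binary.PropositionalEquality using (_≡_)
open import Relation.Nullary using (¬_)

data Code : ℕ → Set where
  zer  : ∀ {n} → Code n
  succ : Code 1
  proj : ∀ {n} → Fin n → Code n
  comp : ∀ {n m} → Code m → Vec (Code n) m → Code n
  prec : ∀ {n} → Code n → Code (suc (suc n)) → Code (suc n)
  mu   : ∀ {n} → Code (suc n) → Code n

mutual
  data _⟦_⟧⇓_ : ∀ {n} → Code n → Vec ℕ n → ℕ → Set where
    ev-zer  : ∀ {n} {xs : Vec ℕ n} → zer ⟦ xs ⟧⇓ 0
    ev-succ : ∀ {x} → succ ⟦ x ∷ [] ⟧⇓ suc x
    ev-proj : ∀ {n} {i : Fin n} {xs} → proj i ⟦ xs ⟧⇓ lookup xs i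
    ev-comp : ∀ {n m} {f : Code m} {gs : Vec (Code n) m} {xs ys v} →
              gs ⟦ xs ⟧⇓* ys → f ⟦ ys ⟧⇓ v → comp f gs ⟦ xs ⟧⇓ v
    ev-prec0 : ∀ {n} {f : Code n} {g} {xs v} →
               f ⟦ xs ⟧⇓ v → prec f g ⟦ 0 ∷ xs ⟧⇓ v
    ev-precS : ∀ {n} {f : Code n} {g} {k xs w v} →
               prec f g ⟦ k ∷ xs ⟧⇓ w → g ⟦ k ∷ w ∷ xs ⟧⇓ v →
               prec f g ⟦ suc k ∷ xs ⟧⇓ v
    ev-mu   : ∀ {n} {f : Code (suc n)} {xs y} →
              f ⟦ y ∷ xs ⟧⇓ 0 →
              (∀ z → z < y → ∃ λ w → f ⟦ z ∷ xs ⟧⇓ suc w) →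
              mu f ⟦ xs ⟧⇓ y

  data _⟦_⟧⇓*_ : ∀ {n m} → Vec (Code n) m → Vec ℕ n → Vec ℕ m → Set where
    ev-[] : ∀ {n} {xs : Vec ℕ n} → [] ⟦ xs ⟧⇓* []
    ev-∷  : ∀ {n m} {g : Code n} {gs : Vec (Code n) m} {xs v vs} →
            g ⟦ xs ⟧⇓ v → gs ⟦ xs ⟧⇓* vs → (g ∷ gs) ⟦ xs ⟧⇓* (v ∷ vs)

Computable : (ℕ → ℕ) → Set
Computable r = Σ (Code 1) λ e → ∀ n → e ⟦ n ∷ [] ⟧⇓ r n

Str : Set
Str = List Bool

-- bijective base-2 coding of binary strings by natural numbers
encode : Str → ℕ
encode []          = 0
encode (false ∷ s) = suc (2 * encode s)
encode (true ∷ s)  = suc (suc (2 * encode s))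

Runs : Code 1 → Str → Str → Set
Runs M σ τ = M ⟦ encode σ ∷ [] ⟧⇓ encode τ

PrefixFree : Code 1 → Set
PrefixFree M = ∀ σ ρ τ τ' → Runs M σ τ → Runs M (σ ++ ρ) τ' → ρ ≡ []

IsOptimalPrefixFree : Code 1 → Set
IsOptimalPrefixFree U =
  PrefixFree U ×
  (∀ M → PrefixFree M → Σ ℕ λ c → ∀ σ τ → Runs M σ τ →
     Σ Str λ σ' → Runs U σ' τ × length σ' ≤ length σ + c)

K≤ : Code 1 → Str → ℕ → Set
K≤ U τ k = Σ Str λ σ → Runs U σ τ × length σ ≤ k

_↾_ : (ℕ → Bool) → ℕ → Str
x ↾ n = map x (upTo n)

-- Dim(x) < 1 :  limsup K(x↾n)/n < 1, i.e. there is a rational p/q < 1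
-- with K(x↾n) ≤ (p/q)·n for all sufficiently large n.
DimLessThanOne : Code 1 → (ℕ → Bool) → Set
DimLessThanOne U x =
  Σ ℕ λ p → Σ ℕ λ q → p < q × (Σ ℕ λ N → ∀ n → N ≤ n →
    Σ ℕ λ k → K≤ U (x ↾ n) k × q * k ≤ p * n)

-- no computable r with K(x↾r(n)) ≤ r(n) − n for all n
-- (with integer subtraction; since K ≥ 0 this forces n ≤ r(n))
StronglyKurtzRandom : Code 1 → (ℕ → Bool) → Set
StronglyKurtzRandom U x =
  ¬ (Σ (ℕ → ℕ) λ r → Computable r ×
       (∀ n → n ≤ r n × K≤ U (x ↾ r n) (r n ∸ n)))

-- If K(x ↾ n) ≤ (p/q)·n for all n ≥ N with p < q, take the computable
-- r(n) = q·(n + N). Writing m = n + N, we get K(x ↾ r(n)) ≤ p·m ≤ q·m − m ≤ r(n) − n.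
{-# OPTIONS --safe #-}
module Submission where

open import Defs
open import Data.Bool using (Bool)
open import Data.Nat using (ℕ; zero; suc; _+_; _*_; _∸_; _≤_; _<_; z≤n; NonZero; >-nonZero)
open import Data.Nat.Properties
open import Data.Fin using () renaming (zero to fzero; suc to fsuc)
open import Data.Vec using ([]; _∷_)
open import Data.Product using (_,_)
open import Relation.Binary.PropositionalEquality using (_≡_; _≗_; sym; cong; subst)
open import Relation.Nullary using (¬_)

Computable-resp-≗ : ∀ {f g : ℕ → ℕ} → f ≗ g → Computable f → Computable g
Computable-resp-≗ f≗g (e , e⇓) = e , λ n → subst (e ⟦ n ∷ [] ⟧⇓_) (f≗g n) (e⇓ n)

plus : ∀ {n} → ℕ → Code n → Code n
plus zero    e = e
plus (suc c) e = comp succ (plus c e ∷ [])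

plus-⇓ : ∀ {n} c {e : Code n} {xs v} → e ⟦ xs ⟧⇓ v → plus c e ⟦ xs ⟧⇓ (c + v)
plus-⇓ zero    e⇓ = e⇓
plus-⇓ (suc c) e⇓ = ev-comp (ev-∷ (plus-⇓ c e⇓) ev-[]) ev-succ

affine : ℕ → ℕ → Code 1
affine a b = prec (plus b zer) (plus a (proj (fsuc fzero)))

affine-⇓ : ∀ a b n → affine a b ⟦ n ∷ [] ⟧⇓ (a * n + b)
affine-⇓ a b zero    = subst (affine a b ⟦ 0 ∷ [] ⟧⇓_) b≡a*0+b
                         (ev-prec0 (plus-⇓ b ev-zer))
  where
  b≡a*0+b : b + 0 ≡ a * 0 + b
  b≡a*0+b rewrite *-zeroʳ a = +-comm b 0
affine-⇓ a b (suc n) = subst (affine a b ⟦ suc n ∷ [] ⟧⇓_) step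
                         (ev-precS (affine-⇓ a b n) (plus-⇓ a ev-proj))
  where
  step : a + (a * n + b) ≡ a * suc n + b
  step rewrite *-suc a n = sym (+-assoc a (a * n) b)

affine-computable : ∀ a b → Computable (λ n → a * n + b)
affine-computable a b = affine a b , affine-⇓ a b

K≤-mono : ∀ {U τ k l} → k ≤ l → K≤ U τ k → K≤ U τ l
K≤-mono k≤l (σ , run , σ≤k) = σ , run , ≤-trans σ≤k k≤l

p*m+n≤q*m : ∀ {p q m n} → p < q → n ≤ m → p * m + n ≤ q * m
p*m+n≤q*m {p} {q} {m} {n} p<q n≤m = begin
  p * m + n  ≤⟨ +-monoʳ-≤ (p * m) n≤m ⟩
  p * m + m  ≡⟨ +-comm (p * m) m ⟩
  suc p * m  ≤⟨ *-monoˡ-≤ m p<q ⟩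
  q * m      ∎
  where open ≤-Reasoning

q*k≤p*[q*m]⇒k≤p*m : ∀ {p q k m} .{{_ : NonZero q}} → q * k ≤ p * (q * m) → k ≤ p * m
q*k≤p*[q*m]⇒k≤p*m {p} {q} {k} {m} q*k≤ = *-cancelˡ-≤ q (begin
  q * k        ≤⟨ q*k≤ ⟩
  p * (q * m)  ≡⟨ sym (*-assoc p q m) ⟩
  p * q * m    ≡⟨ cong (_* m) (*-comm p q) ⟩
  q * p * m    ≡⟨ *-assoc q p m ⟩
  q * (p * m)  ∎)
  where open ≤-Reasoning

ratio-bound⇒deficiency : ∀ {p q k m n} → p < q → n ≤ m →
                         q * k ≤ p * (q * m) → k ≤ q * m ∸ n
ratio-bound⇒deficiency {p} {q} {m = m} p<q n≤m q*k≤ =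
  ≤-trans (q*k≤p*[q*m]⇒k≤p*m {p} q*k≤) (m+n≤o⇒m≤o∸n (p * m) (p*m+n≤q*m p<q n≤m))
  where
  instance
    q≢0 : NonZero q
    q≢0 = >-nonZero (≤-<-trans z≤n p<q)

mainTheorem11 : (U : Code 1) → IsOptimalPrefixFree U →
    (x : ℕ → Bool) → DimLessThanOne U x → ¬ StronglyKurtzRandom U x
mainTheorem11 U _ x (p , q , p<q , N , dim) notRandom =
  notRandom (r , r-computable , λ n → n≤r n , K[x↾r]≤r∸n n)
  where
  instance
    q≢0 : NonZero q
    q≢0 = >-nonZero (≤-<-trans z≤n p<q)
  r : ℕ → ℕ
  r n = q * (n + N)
  r-computable : Computable r
  r-computable = Computable-resp-≗ (λ n → sym (*-distribˡ-+ q n N)) (affine-computable q (q * N))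
  n≤r : ∀ n → n ≤ r n
  n≤r n = ≤-trans (m≤m+n n N) (m≤n*m (n + N) q)
  K[x↾r]≤r∸n : ∀ n → K≤ U (x ↾ r n) (r n ∸ n)
  K[x↾r]≤r∸n n with dim (r n) (≤-trans (m≤n+m N n) (m≤n*m (n + N) q))
  ... | k , K≤k , q*k≤ = K≤-mono (ratio-bound⇒deficiency p<q (m≤m+n n N) q*k≤) K≤k
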